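{- Let $E$ be an inclusion-exclusion-like set-valued expression in $X_1,\dots,X_n$, let $\mathcal{S}$ be its characteristic set, and let $C=\{k: \exists J\in\mathcal{S} \text{ with } |J|=k\}$ be the set of cardinalities of members of $\mathcal{S}$. Let $f=\chi_C$ be the characteristic function of $C$. Then for every sequence of finite sets $\mathcal{A}=(A_1,\dots,A_n)$, $$|E(A_1,\dots,A_n)|=\sum_{k=1}^n c_k\, i_{n,k}(\mathcal{A}),\qquad\text{where } c_k=\sum_{j=1}^k(-1)^{k-j}\binom{k}{j}f(j).$$
   Context: Fix a positive integer $n$ and write $\bar n=\{1,\dots,n\}$. Set-valued expressions in the variables $X_1,\dots,X_n$ are defined recursively: $\emptyset$ is an expression; each $X_i$ is an expression; if $F,F_1,F_2$ are expressions then so are $F^c$, $F_1\cup F_2$, $F_1\cap F_2$. For a sequence of sets $\mathcal{A}=(A_1,\dots,A_n)$ the value $E(\mathcal{A})$ is defined recursively by $\emptyset(\mathcal{A})=\emptyset$, $X_i(\mathcal{A})=A_i$, $(F^c)(\mathcal{A})=(A_1\cup\dots\cup A_n)\setminus F(\mathcal{A})$, $(F_1\cup F_2)(\mathcal{A})=F_1(\mathcal{A})\cup F_2(\mathcal{A})$, $(F_1\cap F_2)(\mathcal{A})=F_1(\mathcal{A})\cap F_2(\mathcal{A})$. Expressions $E,F$ are equivalent, $E\cong F$, if $E(\mathcal{A})=F(\mathcal{A})$ for every sequence of sets $\mathcal{A}$. Finite unions/intersections of expressions are defined up to equivalence; an empty union is $\emptyset$. For $I\subseteq\bar n$ let $G_I=\bigcap_{i\in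 I}X_i\cap\bigcap_{i\in\bar n\setminus I}X_i^c$, and for $\mathcal{S}\subseteq\mathcal{P}(\bar n)$ let $F_{\mathcal{S}}=\bigcup_{I\in\mathcal{S}}G_I$. The characteristic set of $E$ is the unique $\mathcal{S}\subseteq\mathcal{P}(\bar n)\setminus\{\emptyset\}$ with $E\cong F_{\mathcal{S}}$ (such a set exists and is unique). For a sequence of finite sets $\mathcal{A}$ and $1\le k\le n$, $i_{n,k}(\mathcal{A})=\sum_{I\subseteq\bar n,|I|=k}\left|\bigcap_{i\in I}A_i\right|$. An expression $E$ is inclusion-exclusion-like if there exist real constants $c_1,\dots,c_n$ such that for every sequence of finite sets $\mathcal{A}$ one has $|E(\mathcal{A})|=\sum_{k=1}^n c_k\, i_{n,k}(\mathcal{A})$.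
   Formalization: The constants $c_1,\dots,c_n$ in the definition of an inclusion-exclusion-like expression are rational instead of real. -}

module Defs where

open import Data.Bool using (Bool; true; false; if_then_else_)
open import Data.Nat using (ℕ; zero; suc) renaming (_+_ to _+ℕ_)
open import Data.Nat.Properties using (_≟_)
open import Data.Nat.Combinatorics using (_C_)
open import Data.Integer as ℤ using (ℤ; +_; -_)
open import Data.Rational as ℚ using (ℚ)
open import Data.Fin using (Fin)
open import Data.Fin.Subset using (Subset; inside; outside; ⊥; ⊤; ∁; _∩_; _∪_; ⋃; ⋂; ∣_∣; Nonempty)
open import Data.List using (List; []; _∷_; _++_; map; foldr; filter; allFin; tabulate)
open import Data.Nat.ListAction using (sum)
open import Data.List.Relation.Unary.All using (All)
open import Data.List.Relation.Unary.Any using (any?)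
open import Data.Vec using ([]; _∷_)
open import Relation.Nullary using (does)
open import Relation.Binary.PropositionalEquality using (_≡_)

data Expr (n : ℕ) : Set where
  ∅    : Expr n
  X    : Fin n → Expr n
  _ᶜ   : Expr n → Expr n
  _∪ₑ_ : Expr n → Expr n → Expr n
  _∩ₑ_ : Expr n → Expr n → Expr n

-- A sequence of finite sets A_1 … A_n, all taken inside a finite ambient
-- type Fin m (every sequence of finite sets is, up to renaming, of this form).
Family : ℕ → ℕ → Set
Family n m = Fin n → Subset m

unionAll : ∀ {n m} → Family n m → Subset m
unionAll {n} A = ⋃ (tabulate A)

eval : ∀ {n m} → Expr n → Family n m → Subset m
eval ∅         A = ⊥
eval (X i)     A = A i
eval (F ᶜ)     A = unionAll A ∩ ∁ (eval F A)
eval (F ∪ₑ G)  A = eval F A ∪ eval G A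
eval (F ∩ₑ G)  A = eval F A ∩ eval G A

_≅_ : ∀ {n} → Expr n → Expr n → Set
_≅_ {n} E F = ∀ (m : ℕ) (A : Family n m) → eval E A ≡ eval F A

-- Finite union / intersection of expressions (empty union is ∅; the empty
-- intersection is taken to be ∅ᶜ, i.e. the ambient union, which is neutral).
⋃ₑ : ∀ {n} → List (Expr n) → Expr n
⋃ₑ = foldr _∪ₑ_ ∅

⋂ₑ : ∀ {n} → List (Expr n) → Expr n
⋂ₑ = foldr _∩ₑ_ (∅ ᶜ)

G : ∀ {n} → Subset n → Expr n
G {n} I = ⋂ₑ (map lit (allFin n))
  where
  lit : Fin n → Expr n
  lit i with Data.Vec.lookup I i
  ... | true  = X i
  ... | false = X i ᶜ

F_ : ∀ {n} → List (Subset n) → Expr n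
F_ S = ⋃ₑ (map G S)

IsCharacteristicSet : ∀ {n} → Expr n → List (Subset n) → Set
IsCharacteristicSet E S = All Nonempty S × (E ≅ F_ S)
  where open import Data.Product using (_×_)

allSubsets : ∀ n → List (Subset n)
allSubsets zero    = [] ∷ []
allSubsets (suc n) = map (outside ∷_) (allSubsets n) ++ map (inside ∷_) (allSubsets n)

interOver : ∀ {n m} → Subset n → Family n m → Subset m
interOver {n} I A = ⋂ (map A (filter (λ i → Data.Vec.lookup I i Data.Bool.≟ true) (allFin n)))

i[_,_] : ∀ n {m} → ℕ → Family n m → ℕ
i[ n , k ] A = sum (map (λ I → ∣ interOver I A ∣) (filter (λ I → ∣ I ∣ ≟ k) (allSubsets n)))

Σℤ[1…_] : ℕ → (ℕ → ℤ) → ℤ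
Σℤ[1… zero  ] g = + 0
Σℤ[1… suc n ] g = Σℤ[1… n ] g ℤ.+ g (suc n)

Σℚ[1…_] : ℕ → (ℕ → ℚ) → ℚ
Σℚ[1… zero  ] g = ℚ.0ℚ
Σℚ[1… suc n ] g = Σℚ[1… n ] g ℚ.+ g (suc n)

ℕ→ℚ : ℕ → ℚ
ℕ→ℚ k = (+ k) ℚ./ 1

IncExcLike : ∀ {n} → Expr n → Set
IncExcLike {n} E =
  Σ (ℕ → ℚ) λ c → ∀ (m : ℕ) (A : Family n m) →
    ℕ→ℚ ∣ eval E A ∣ ≡ Σℚ[1… n ] (λ k → c k ℚ.* ℕ→ℚ (i[ n , k ] A))
  where open import Data.Product using (Σ)

χC : ∀ {n} → List (Subset n) → ℕ → ℤ
χC S j = if does (any? (λ J → ∣ J ∣ ≟ j) S) then + 1 else + 0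

coeff : ∀ {n} → List (Subset n) → ℕ → ℤ
coeff S k = Σℤ[1… k ] (λ j → ((- + 1) ℤ.^ (k Data.Nat.∸ j)) ℤ.* (+ (k C j)) ℤ.* χC S j)

{-# OPTIONS --safe #-}
module Submission where

open import Defs
open import Data.Nat.Base as ℕ using (ℕ; zero; suc; _≤_; _<_; z≤n; s≤s; pred; _∸_)
import Data.Nat.Properties as ℕ
open import Data.Nat.Combinatorics using (_C_; k>n⇒nCk≡0; nCk+nC[k+1]≡[n+1]C[k+1])
open import Data.Nat.ListAction using (sum)
open import Data.Nat.ListAction.Properties using (sum-++)
open import Data.Integer using (ℤ; +_; _*_; _+_; _-_; _^_; -1ℤ)
open import Data.Integer.Properties
  using (+-assoc; *-assoc; +-comm; +-identityˡ; +-identityʳ; *-identityˡ; *-identityʳ; *-zeroʳ; *-comm;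
         *-distribˡ-+; *-distribʳ-+; pos-+; +-commutativeSemigroup; *-commutativeSemigroup)
open import Data.Integer.Tactic.RingSolver using (solve-∀)
open import Data.Rational as ℚ using (ℚ)
open import Algebra.Properties.CommutativeSemigroup +-commutativeSemigroup using (interchange)
open import Algebra.Properties.CommutativeSemigroup *-commutativeSemigroup using (x∙yz≈y∙xz)
open import Algebra.Properties.CommutativeSemigroup ℕ.+-commutativeSemigroup
  using () renaming (interchange to ℕ-interchange)
open import Data.Bool as Bool using (Bool; true; false; T; not; _∧_; _∨_; if_then_else_)
open import Data.Bool.Properties using (T-∧; T-∨; T-≡; T-not-≡)
open import Data.Bool.ListAction using (and; all; any)
open import Data.Fin using (Fin; zero; suc)
open import Data.Fin.Subset using (Subset; inside; outside; _∩_; _∪_; ∁; ⋂; ∣_∣; Nonempty)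
open import Data.Fin.Subset.Properties using (_⊆?_; p⊂q⇒∣p∣<∣q∣; ⊆-min; ∉⊥; ∣p∣≤n)
open import Data.Vec as Vec using ([]; _∷_; head; tail; lookup; here; there)
open import Data.Vec.Properties using (lookup∘tabulate; tabulate∘lookup; tabulate-cong)
open import Data.List as List using (List; []; _∷_; _++_; map; filter; allFin)
open import Data.List.Properties using (map-++; map-∘; map-cong; map-tabulate; filter-++; filter-≐; filter-none)
open import Data.List.Relation.Unary.All as All using (All; []; _∷_)
open import Data.List.Relation.Unary.All.Properties using (map⁺; map⁻; tabulate⁺; tabulate⁻; All¬⇒¬Any)
open import Data.List.Relation.Unary.Any as Any using (Any; any?)
open import Data.List.Relation.Unary.Any.Properties using (any⁺; any⁻)
open import Data.List.Membership.Propositional using (find; lose)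
open import Data.Product using (_,_; proj₁; proj₂; Σ-syntax)
open import Data.Sum using (inj₁; inj₂)
open import Function using (_∘_; _⇔_; id)
open import Function.Bundles using (Equivalence; mk⇔)
open import Relation.Nullary using (does; proof)
open import Relation.Nullary.Decidable using (dec-false)
open import Relation.Nullary.Reflects using (fromEquivalence; det)
open import Relation.Unary using (Decidable)
open import Relation.Binary.PropositionalEquality
open ≡-Reasoning

-- Whether a point lies in E(A) depends only on its membership pattern p ⊆ n̄ (the set of i
-- with the point in A_i), so |E(A)| and each i_{n,k}(A) are sums over the points of
-- [p ∈ E] and of C(|p|, k) respectively. Evaluating the inclusion–exclusion formula on
-- one-point families shows that [p ∈ E] depends only on |p|, and the characteristic set
-- identifies it with f(|p|). So it suffices that f(t) = Σ_k c_k C(t, k) for 0 ≤ t ≤ n: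
-- binomial inversion, which follows from Newton's forward-difference formula
-- f(t) = Σ_k C(t, k) (Δ^k f)(0) and the alternating-sum formula for (Δ^k f)(0).

-- Finite sums

Σℤ-cong : ∀ n {f g : ℕ → ℤ} → (∀ k → f (suc k) ≡ g (suc k)) → Σℤ[1… n ] f ≡ Σℤ[1… n ] g
Σℤ-cong zero    f≗g = refl
Σℤ-cong (suc n) f≗g = cong₂ _+_ (Σℤ-cong n f≗g) (f≗g n)

Σℤ-+ : ∀ n (f g : ℕ → ℤ) → Σℤ[1… n ] (λ k → f k + g k) ≡ Σℤ[1… n ] f + Σℤ[1… n ] g
Σℤ-+ zero    f g = refl
Σℤ-+ (suc n) f g = trans (cong (_+ (f (suc n) + g (suc n))) (Σℤ-+ n f g))
                         (interchange (Σℤ[1… n ] f) (Σℤ[1… n ] g) (f (suc n)) (g (suc n)))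

Σℤ-*ˡ : ∀ n x (f : ℕ → ℤ) → Σℤ[1… n ] (λ k → x * f k) ≡ x * Σℤ[1… n ] f
Σℤ-*ˡ zero    x f = sym (*-zeroʳ x)
Σℤ-*ˡ (suc n) x f = trans (cong (_+ x * f (suc n)) (Σℤ-*ˡ n x f)) (sym (*-distribˡ-+ x _ _))

Σℤ-uncons : ∀ n (f : ℕ → ℤ) → Σℤ[1… suc n ] f ≡ f 1 + Σℤ[1… n ] (f ∘ suc)
Σℤ-uncons zero    f = trans (+-identityˡ (f 1)) (sym (+-identityʳ (f 1)))
Σℤ-uncons (suc n) f = trans (cong (_+ f (suc (suc n))) (Σℤ-uncons n f)) (+-assoc (f 1) _ _)

Σℤ-truncate : ∀ {t n} (f : ℕ → ℤ) → t ≤ n → (∀ k → t < k → f k ≡ + 0) →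
              Σℤ[1… n ] f ≡ Σℤ[1… t ] f
Σℤ-truncate {n = zero}  f z≤n    vanish = refl
Σℤ-truncate {n = suc n} f t≤1+n vanish with ℕ.m≤n⇒m<n∨m≡n t≤1+n
... | inj₂ refl       = refl
... | inj₁ (s≤s t≤n) =
  trans (cong₂ _+_ (Σℤ-truncate f t≤n vanish) (vanish (suc n) (s≤s t≤n))) (+-identityʳ _)

Σℚ-cong : ∀ n {f g : ℕ → ℚ} → (∀ k → f k ≡ g k) → Σℚ[1… n ] f ≡ Σℚ[1… n ] g
Σℚ-cong zero    f≗g = refl
Σℚ-cong (suc n) f≗g = cong₂ ℚ._+_ (Σℚ-cong n f≗g) (f≗g (suc n))

filter-map : ∀ {A B : Set} {P : B → Set} (P? : Decidable P) (f : A → B) xs →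
             filter P? (map f xs) ≡ map f (filter (P? ∘ f) xs)
filter-map P? f []       = refl
filter-map P? f (x ∷ xs) with does (P? (f x))
... | true  = cong (f x ∷_) (filter-map P? f xs)
... | false = filter-map P? f xs

sum-map-+ : ∀ {A : Set} (f g : A → ℕ) xs →
            sum (map (λ x → f x ℕ.+ g x) xs) ≡ sum (map f xs) ℕ.+ sum (map g xs)
sum-map-+ f g []       = refl
sum-map-+ f g (x ∷ xs) =
  trans (cong (f x ℕ.+ g x ℕ.+_) (sum-map-+ f g xs)) (ℕ-interchange (f x) (g x) _ _)

sum-map-zero : ∀ {A : Set} {f : A → ℕ} → (∀ x → f x ≡ 0) → ∀ xs → sum (map f xs) ≡ 0
sum-map-zero f≗0 []       = refl
sum-map-zero f≗0 (x ∷ xs) = cong₂ ℕ._+_ (f≗0 x) (sum-map-zero f≗0 xs)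

-- Binomial inversion

binomialTransform : ℕ → (ℕ → ℤ) → ℤ
binomialTransform t a = a 0 + Σℤ[1… t ] (λ k → + (t C k) * a k)

binomialTransform-from-1 : ∀ t (a : ℕ → ℤ) → a 0 ≡ + 0 →
                           binomialTransform t a ≡ Σℤ[1… t ] (λ k → + (t C k) * a k)
binomialTransform-from-1 t a a₀≡0 =
  trans (cong (_+ Σℤ[1… t ] (λ k → + (t C k) * a k)) a₀≡0) (+-identityˡ _)

binomialTransform-cong : ∀ t {a b : ℕ → ℤ} → (∀ k → a k ≡ b k) →
                         binomialTransform t a ≡ binomialTransform t b
binomialTransform-cong t a≗b =
  cong₂ _+_ (a≗b 0) (Σℤ-cong t (λ k → cong (+ (t C suc k) *_) (a≗b (suc k))))

binomialTransform-+ : ∀ t (a b : ℕ → ℤ) →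
  binomialTransform t (λ k → a k + b k) ≡ binomialTransform t a + binomialTransform t b
binomialTransform-+ t a b = begin
  a 0 + b 0 + Σℤ[1… t ] (λ k → + (t C k) * (a k + b k))
    ≡⟨ cong (_+_ (a 0 + b 0)) (trans (Σℤ-cong t (λ k → *-distribˡ-+ (+ (t C suc k)) _ _))
                                     (Σℤ-+ t _ _)) ⟩
  a 0 + b 0 + (Σℤ[1… t ] (λ k → + (t C k) * a k) + Σℤ[1… t ] (λ k → + (t C k) * b k))
    ≡⟨ interchange (a 0) (b 0) _ _ ⟩
  binomialTransform t a + binomialTransform t b ∎

binomialTransform-*ˡ : ∀ t x (a : ℕ → ℤ) →
  binomialTransform t (λ k → x * a k) ≡ x * binomialTransform t a
binomialTransform-*ˡ t x a = begin
  x * a 0 + Σℤ[1… t ] (λ k → + (t C k) * (x * a k))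
    ≡⟨ cong (_+_ (x * a 0)) (trans (Σℤ-cong t (λ k → x∙yz≈y∙xz (+ (t C suc k)) x (a (suc k))))
                                   (Σℤ-*ˡ t x _)) ⟩
  x * a 0 + x * Σℤ[1… t ] (λ k → + (t C k) * a k)
    ≡⟨ sym (*-distribˡ-+ x _ _) ⟩
  x * binomialTransform t a ∎

binomialTransform-suc : ∀ t (a : ℕ → ℤ) →
  binomialTransform (suc t) a ≡ binomialTransform t a + binomialTransform t (a ∘ suc)
binomialTransform-suc t a = begin
  a 0 + Σℤ[1… suc t ] (λ k → + (suc t C k) * a k)
    ≡⟨ cong (_+_ (a 0)) (trans (Σℤ-cong (suc t) pascal) (Σℤ-+ (suc t) _ _)) ⟩
  a 0 + (Σℤ[1… suc t ] (λ k → + (t C k) * a k) + Σℤ[1… suc t ] (λ k → + (t C pred k) * a k))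
    ≡⟨ cong (_+_ (a 0)) (cong₂ _+_ top-term-vanishes (Σℤ-uncons t _)) ⟩
  a 0 + (Σℤ[1… t ] (λ k → + (t C k) * a k) + (+ 1 * a 1 + shifted))
    ≡⟨ sym (+-assoc (a 0) _ _) ⟩
  binomialTransform t a + (+ 1 * a 1 + shifted)
    ≡⟨ cong (λ x → binomialTransform t a + (x + shifted)) (*-identityˡ (a 1)) ⟩
  binomialTransform t a + binomialTransform t (a ∘ suc) ∎
  where
  shifted : ℤ
  shifted = Σℤ[1… t ] (λ k → + (t C k) * a (suc k))
  pascal : ∀ k → + (suc t C suc k) * a (suc k) ≡ + (t C suc k) * a (suc k) + + (t C k) * a (suc k)
  pascal k = begin
    + (suc t C suc k) * a (suc k)
      ≡⟨ cong (λ c → + c * a (suc k)) (sym (nCk+nC[k+1]≡[n+1]C[k+1] t k)) ⟩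
    + (t C k ℕ.+ t C suc k) * a (suc k)
      ≡⟨ cong (_* a (suc k)) (trans (pos-+ (t C k) (t C suc k)) (+-comm (+ (t C k)) (+ (t C suc k)))) ⟩
    (+ (t C suc k) + + (t C k)) * a (suc k)
      ≡⟨ *-distribʳ-+ (a (suc k)) (+ (t C suc k)) (+ (t C k)) ⟩
    + (t C suc k) * a (suc k) + + (t C k) * a (suc k) ∎
  top-term-vanishes : Σℤ[1… suc t ] (λ k → + (t C k) * a k) ≡ Σℤ[1… t ] (λ k → + (t C k) * a k)
  top-term-vanishes rewrite k>n⇒nCk≡0 (ℕ.n<1+n t) = +-identityʳ _

Δ : (ℕ → ℤ) → ℕ → ℤ
Δ g x = g (suc x) - g x

Δ^ : ℕ → (ℕ → ℤ) → ℕ → ℤ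
Δ^ zero    g = g
Δ^ (suc k) g = Δ^ k (Δ g)

newton-forward : ∀ t (g : ℕ → ℤ) → g t ≡ binomialTransform t (λ k → Δ^ k g 0)
newton-forward zero    g = sym (+-identityʳ (g 0))
newton-forward (suc t) g = begin
  g (suc t)
    ≡⟨ sym (x+[y-x]≡y (g t) (g (suc t))) ⟩
  g t + Δ g t
    ≡⟨ cong₂ _+_ (newton-forward t g) (newton-forward t (Δ g)) ⟩
  binomialTransform t (λ k → Δ^ k g 0) + binomialTransform t (λ k → Δ^ (suc k) g 0)
    ≡⟨ sym (binomialTransform-suc t (λ k → Δ^ k g 0)) ⟩
  binomialTransform (suc t) (λ k → Δ^ k g 0) ∎
  where
  x+[y-x]≡y : ∀ x y → x + (y - x) ≡ y
  x+[y-x]≡y = solve-∀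

Δ^-alternating : ∀ k (g : ℕ → ℤ) → Δ^ k g 0 ≡ -1ℤ ^ k * binomialTransform k (λ j → -1ℤ ^ j * g j)
Δ^-alternating zero    g = sym (trans (*-identityˡ _) (trans (+-identityʳ _) (*-identityˡ (g 0))))
Δ^-alternating (suc k) g = begin
  Δ^ k (Δ g) 0
    ≡⟨ Δ^-alternating k (Δ g) ⟩
  -1ℤ ^ k * binomialTransform k (λ j → -1ℤ ^ j * (g (suc j) - g j))
    ≡⟨ cong (-1ℤ ^ k *_) (trans (binomialTransform-cong k (λ j → split (-1ℤ ^ j) (g (suc j)) (g j)))
                                (binomialTransform-+ k shifted (λ j → -1ℤ * alternating j))) ⟩
  -1ℤ ^ k * (binomialTransform k shifted + binomialTransform k (λ j → -1ℤ * alternating j))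
    ≡⟨ cong (λ x → -1ℤ ^ k * (binomialTransform k shifted + x))
            (binomialTransform-*ˡ k -1ℤ alternating) ⟩
  -1ℤ ^ k * (binomialTransform k shifted + -1ℤ * binomialTransform k alternating)
    ≡⟨ flip-sign (-1ℤ ^ k) (binomialTransform k alternating) (binomialTransform k shifted) ⟩
  -1ℤ ^ suc k * (binomialTransform k alternating + -1ℤ * binomialTransform k shifted)
    ≡⟨ cong (λ x → -1ℤ ^ suc k * (binomialTransform k alternating + x))
            (sym (binomialTransform-*ˡ k -1ℤ shifted)) ⟩
  -1ℤ ^ suc k * (binomialTransform k alternating + binomialTransform k (λ j → -1ℤ * shifted j))
    ≡⟨ cong (λ x → -1ℤ ^ suc k * (binomialTransform k alternating + x))
            (binomialTransform-cong k (λ j → sym (*-assoc -1ℤ (-1ℤ ^ j) (g (suc j))))) ⟩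
  -1ℤ ^ suc k * (binomialTransform k alternating + binomialTransform k (alternating ∘ suc))
    ≡⟨ cong (-1ℤ ^ suc k *_) (sym (binomialTransform-suc k alternating)) ⟩
  -1ℤ ^ suc k * binomialTransform (suc k) alternating ∎
  where
  alternating shifted : ℕ → ℤ
  alternating j = -1ℤ ^ j * g j
  shifted     j = -1ℤ ^ j * g (suc j)
  split : ∀ s x y → s * (x - y) ≡ s * x + -1ℤ * (s * y)
  split = solve-∀
  flip-sign : ∀ s a b → s * (b + -1ℤ * a) ≡ (-1ℤ * s) * (a + -1ℤ * b)
  flip-sign = solve-∀

binomialInverse : (ℕ → ℤ) → ℕ → ℤ
binomialInverse f k = Σℤ[1… k ] (λ j → -1ℤ ^ (k ∸ j) * + (k C j) * f j)

-1^[k∸j] : ∀ {j k} → j ≤ k → -1ℤ ^ (k ∸ j) ≡ -1ℤ ^ k * -1ℤ ^ j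
-1^[k∸j] {zero}          _         = sym (*-identityʳ _)
-1^[k∸j] {suc j} {suc k} (s≤s j≤k) = trans (-1^[k∸j] j≤k) (negate-both (-1ℤ ^ k) (-1ℤ ^ j))
  where
  negate-both : ∀ a b → a * b ≡ (-1ℤ * a) * (-1ℤ * b)
  negate-both = solve-∀

binomialInverse-term : ∀ k j x → -1ℤ ^ (k ∸ j) * + (k C j) * x ≡ -1ℤ ^ k * (+ (k C j) * (-1ℤ ^ j * x))
binomialInverse-term k j x with ℕ.≤-<-connex j k
... | inj₁ j≤k rewrite -1^[k∸j] j≤k = regroup (-1ℤ ^ k) (-1ℤ ^ j) (+ (k C j)) x
  where
  regroup : ∀ a b c x → a * b * c * x ≡ a * (c * (b * x))
  regroup = solve-∀
... | inj₂ k<j rewrite k>n⇒nCk≡0 k<j =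
  trans (cong (_* x) (*-zeroʳ (-1ℤ ^ (k ∸ j)))) (sym (*-zeroʳ (-1ℤ ^ k)))

binomialInverse≡Δ^ : ∀ (f : ℕ → ℤ) → f 0 ≡ + 0 → ∀ k → binomialInverse f k ≡ Δ^ k f 0
binomialInverse≡Δ^ f f₀≡0 k = begin
  binomialInverse f k
    ≡⟨ Σℤ-cong k (λ j → binomialInverse-term k (suc j) (f (suc j))) ⟩
  Σℤ[1… k ] (λ j → -1ℤ ^ k * (+ (k C j) * (-1ℤ ^ j * f j)))
    ≡⟨ Σℤ-*ˡ k (-1ℤ ^ k) _ ⟩
  -1ℤ ^ k * Σℤ[1… k ] (λ j → + (k C j) * (-1ℤ ^ j * f j))
    ≡⟨ cong (-1ℤ ^ k *_) (sym (binomialTransform-from-1 k _ (trans (*-identityˡ (f 0)) f₀≡0))) ⟩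
  -1ℤ ^ k * binomialTransform k (λ j → -1ℤ ^ j * f j)
    ≡⟨ sym (Δ^-alternating k f) ⟩
  Δ^ k f 0 ∎

binomial-inversion : ∀ (f : ℕ → ℤ) {n t} → f 0 ≡ + 0 → t ≤ n →
  Σℤ[1… n ] (λ k → binomialInverse f k * + (t C k)) ≡ f t
binomial-inversion f {n} {t} f₀≡0 t≤n = begin
  Σℤ[1… n ] (λ k → binomialInverse f k * + (t C k))
    ≡⟨ Σℤ-truncate _ t≤n beyond-t ⟩
  Σℤ[1… t ] (λ k → binomialInverse f k * + (t C k))
    ≡⟨ Σℤ-cong t (λ k → trans (cong (_* + (t C suc k)) (binomialInverse≡Δ^ f f₀≡0 (suc k)))
                              (*-comm (Δ^ (suc k) f 0) (+ (t C suc k)))) ⟩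
  Σℤ[1… t ] (λ k → + (t C k) * Δ^ k f 0)
    ≡⟨ sym (binomialTransform-from-1 t _ f₀≡0) ⟩
  binomialTransform t (λ k → Δ^ k f 0)
    ≡⟨ sym (newton-forward t f) ⟩
  f t ∎
  where
  beyond-t : ∀ k → t < k → binomialInverse f k * + (t C k) ≡ + 0
  beyond-t k t<k rewrite k>n⇒nCk≡0 t<k = *-zeroʳ (binomialInverse f k)

-- Membership patterns

𝟙 : Bool → ℕ
𝟙 false = 0
𝟙 true  = 1

∣b∷p∣≡𝟙b+∣p∣ : ∀ {m} b (p : Subset m) → ∣ b ∷ p ∣ ≡ 𝟙 b ℕ.+ ∣ p ∣
∣b∷p∣≡𝟙b+∣p∣ true  p = refl
∣b∷p∣≡𝟙b+∣p∣ false p = refl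

∣p∣≡0 : (p : Subset 0) → ∣ p ∣ ≡ 0
∣p∣≡0 [] = refl

Nonempty⇒∣p∣≢0 : ∀ {n} {p : Subset n} → Nonempty p → ∣ p ∣ ≢ 0
Nonempty⇒∣p∣≢0 (x , x∈p) = ℕ.m<n⇒n≢0 (p⊂q⇒∣p∣<∣q∣ (⊆-min _ , x , x∈p , ∉⊥))

nonempty : ∀ {n} → Subset n → Bool
nonempty []      = false
nonempty (b ∷ p) = b ∨ nonempty p

Nonempty⇒T-nonempty : ∀ {n} {p : Subset n} → Nonempty p → T (nonempty p)
Nonempty⇒T-nonempty (zero  , here)       = _
Nonempty⇒T-nonempty (suc x , there x∈p) = Equivalence.from T-∨ (inj₂ (Nonempty⇒T-nonempty (x , x∈p)))

-- evalᵇ E p decides whether a point lying in exactly the sets A_i with i ∈ p belongs to E(A).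
evalᵇ : ∀ {n} → Expr n → Subset n → Bool
evalᵇ ∅          p = false
evalᵇ (X i)      p = lookup p i
evalᵇ (E ᶜ)      p = nonempty p ∧ not (evalᵇ E p)
evalᵇ (E₁ ∪ₑ E₂) p = evalᵇ E₁ p ∨ evalᵇ E₂ p
evalᵇ (E₁ ∩ₑ E₂) p = evalᵇ E₁ p ∧ evalᵇ E₂ p

-- A family is read as a Boolean n × m matrix whose columns are the membership patterns of the points.
headColumn : ∀ {n m} → Family n (suc m) → Subset n
headColumn A = Vec.tabulate (λ i → head (A i))

tailColumns : ∀ {n m} → Family n (suc m) → Family n m
tailColumns A i = tail (A i)

head∷tail : ∀ {m} (v : Subset (suc m)) → v ≡ head v ∷ tail v
head∷tail (b ∷ v) = refl

family-∷ : ∀ {n m} (A : Family n (suc m)) i → A i ≡ lookup (headColumn A) i ∷ tailColumns A i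
family-∷ A i = trans (head∷tail (A i)) (cong (_∷ tail (A i)) (sym (lookup∘tabulate (λ i → head (A i)) i)))

unionAll-∷ : ∀ {n m} (A : Family n (suc m)) →
             unionAll A ≡ nonempty (headColumn A) ∷ unionAll (tailColumns A)
unionAll-∷ {zero}  A = refl
unionAll-∷ {suc n} A = cong₂ _∪_ (head∷tail (A zero)) (unionAll-∷ (A ∘ suc))

eval-∷ : ∀ {n m} (E : Expr n) (A : Family n (suc m)) →
         eval E A ≡ evalᵇ E (headColumn A) ∷ eval E (tailColumns A)
eval-∷ ∅          A = refl
eval-∷ (X i)      A = family-∷ A i
eval-∷ (E ᶜ)      A = cong₂ (λ u v → u ∩ ∁ v) (unionAll-∷ A) (eval-∷ E A)
eval-∷ (E₁ ∪ₑ E₂) A = cong₂ _∪_ (eval-∷ E₁ A) (eval-∷ E₂ A)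
eval-∷ (E₁ ∩ₑ E₂) A = cong₂ _∩_ (eval-∷ E₁ A) (eval-∷ E₂ A)

-- Counting intersections

elements : ∀ {n} → Subset n → List (Fin n)
elements {n} I = filter (λ i → lookup I i Bool.≟ true) (allFin n)

all-elements-∷ : ∀ {n} b c (I p : Subset n) →
  all (lookup (c ∷ p)) (filter (λ i → lookup (b ∷ I) i Bool.≟ true) (List.tabulate suc)) ≡
  all (lookup p) (elements I)
all-elements-∷ {n} b c I p = begin
  all (lookup (c ∷ p)) (filter _ (List.tabulate suc))
    ≡⟨ cong (all (lookup (c ∷ p)) ∘ filter _) (sym (map-tabulate id suc)) ⟩
  all (lookup (c ∷ p)) (filter _ (map suc (allFin n)))
    ≡⟨ cong (all (lookup (c ∷ p))) (filter-map _ suc (allFin n)) ⟩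
  all (lookup (c ∷ p)) (map suc (elements I))
    ≡⟨ cong and (sym (map-∘ (elements I))) ⟩
  all (lookup p) (elements I) ∎

all-elements : ∀ {n} (I p : Subset n) → all (lookup p) (elements I) ≡ does (I ⊆? p)
all-elements []            []            = refl
all-elements (outside ∷ I) (c ∷ p)       = trans (all-elements-∷ outside c I p) (all-elements I p)
all-elements (inside ∷ I)  (outside ∷ p) = refl
all-elements (inside ∷ I)  (inside ∷ p)  = trans (all-elements-∷ inside inside I p) (all-elements I p)

⋂-∷ : ∀ {n m} (A : Family n (suc m)) xs →
      ⋂ (map A xs) ≡ all (lookup (headColumn A)) xs ∷ ⋂ (map (tailColumns A) xs)
⋂-∷ A []       = refl
⋂-∷ A (x ∷ xs) = cong₂ _∩_ (family-∷ A x) (⋂-∷ A xs)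

interOver-∷ : ∀ {n m} (I : Subset n) (A : Family n (suc m)) →
              interOver I A ≡ does (I ⊆? headColumn A) ∷ interOver I (tailColumns A)
interOver-∷ I A =
  trans (⋂-∷ A (elements I)) (cong (_∷ interOver I (tailColumns A)) (all-elements I (headColumn A)))

kSubsets : ∀ n → ℕ → List (Subset n)
kSubsets n k = filter (λ I → ∣ I ∣ ℕ.≟ k) (allSubsets n)

kSubsets-suc : ∀ n k → kSubsets (suc n) k ≡
  map (outside ∷_) (kSubsets n k) ++ map (inside ∷_) (filter (λ I → suc ∣ I ∣ ℕ.≟ k) (allSubsets n))
kSubsets-suc n k = trans (filter-++ (λ I → ∣ I ∣ ℕ.≟ k) (map (outside ∷_) (allSubsets n)) _)
  (cong₂ _++_ (filter-map (λ I → ∣ I ∣ ℕ.≟ k) (outside ∷_) (allSubsets n))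
              (filter-map (λ I → ∣ I ∣ ℕ.≟ k) (inside ∷_) (allSubsets n)))

kSubsetsWithin : ∀ {n} → ℕ → Subset n → ℕ
kSubsetsWithin {n} k p = sum (map (λ I → 𝟙 (does (I ⊆? p))) (kSubsets n k))

kSubsetsWithin-∷ : ∀ {n} k b (p : Subset n) → kSubsetsWithin k (b ∷ p) ≡
  kSubsetsWithin k p ℕ.+
  sum (map (λ I → 𝟙 (does (inside ∷ I ⊆? b ∷ p))) (filter (λ I → suc ∣ I ∣ ℕ.≟ k) (allSubsets n)))
kSubsetsWithin-∷ {n} k b p = begin
  sum (map h (kSubsets (suc n) k))
    ≡⟨ cong (sum ∘ map h) (kSubsets-suc n k) ⟩
  sum (map h (map (outside ∷_) (kSubsets n k) ++ map (inside ∷_) L))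
    ≡⟨ cong sum (map-++ h (map (outside ∷_) (kSubsets n k)) (map (inside ∷_) L)) ⟩
  sum (map h (map (outside ∷_) (kSubsets n k)) ++ map h (map (inside ∷_) L))
    ≡⟨ sum-++ (map h (map (outside ∷_) (kSubsets n k))) (map h (map (inside ∷_) L)) ⟩
  sum (map h (map (outside ∷_) (kSubsets n k))) ℕ.+ sum (map h (map (inside ∷_) L))
    ≡⟨ cong₂ ℕ._+_ (cong sum (sym (map-∘ (kSubsets n k)))) (cong sum (sym (map-∘ L))) ⟩
  kSubsetsWithin k p ℕ.+ sum (map (h ∘ (inside ∷_)) L) ∎
  where
  L : List (Subset n)
  L = filter (λ I → suc ∣ I ∣ ℕ.≟ k) (allSubsets n)
  h : Subset (suc n) → ℕ
  h I = 𝟙 (does (I ⊆? b ∷ p))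

kSubsetsWithin≡C : ∀ {n} k (p : Subset n) → kSubsetsWithin k p ≡ ∣ p ∣ C k
kSubsetsWithin≡C zero    []      = refl
kSubsetsWithin≡C (suc k) []      = refl
kSubsetsWithin≡C {suc n} zero    (b ∷ p) = begin
  kSubsetsWithin 0 (b ∷ p)
    ≡⟨ kSubsetsWithin-∷ 0 b p ⟩
  kSubsetsWithin 0 p ℕ.+ sum (map _ (filter (λ I → suc ∣ I ∣ ℕ.≟ 0) (allSubsets n)))
    ≡⟨ cong₂ ℕ._+_ (kSubsetsWithin≡C 0 p)
         (cong (sum ∘ map _) (filter-none (λ I → suc ∣ I ∣ ℕ.≟ 0)
                                          (All.universal (λ _ ()) (allSubsets n)))) ⟩
  1 ∎
kSubsetsWithin≡C {suc n} (suc k) (b ∷ p) = begin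
  kSubsetsWithin (suc k) (b ∷ p)
    ≡⟨ kSubsetsWithin-∷ (suc k) b p ⟩
  kSubsetsWithin (suc k) p ℕ.+ sum (map _ (filter (λ I → suc ∣ I ∣ ℕ.≟ suc k) (allSubsets n)))
    ≡⟨ cong₂ ℕ._+_ (kSubsetsWithin≡C (suc k) p)
         (cong (sum ∘ map _) (filter-≐ (λ I → suc ∣ I ∣ ℕ.≟ suc k) (λ I → ∣ I ∣ ℕ.≟ k)
                                       (ℕ.suc-injective , cong suc) (allSubsets n))) ⟩
  ∣ p ∣ C suc k ℕ.+ sum (map (λ I → 𝟙 (does (inside ∷ I ⊆? b ∷ p))) (kSubsets n k))
    ≡⟨ add-inside b ⟩
  ∣ b ∷ p ∣ C suc k ∎
  where
  add-inside : ∀ b →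
    ∣ p ∣ C suc k ℕ.+ sum (map (λ I → 𝟙 (does (inside ∷ I ⊆? b ∷ p))) (kSubsets n k)) ≡ ∣ b ∷ p ∣ C suc k
  add-inside outside =
    trans (cong (∣ p ∣ C suc k ℕ.+_) (sum-map-zero (λ _ → refl) (kSubsets n k))) (ℕ.+-identityʳ _)
  add-inside inside  = begin
    ∣ p ∣ C suc k ℕ.+ kSubsetsWithin k p ≡⟨ cong (∣ p ∣ C suc k ℕ.+_) (kSubsetsWithin≡C k p) ⟩
    ∣ p ∣ C suc k ℕ.+ ∣ p ∣ C k          ≡⟨ ℕ.+-comm (∣ p ∣ C suc k) _ ⟩
    ∣ p ∣ C k ℕ.+ ∣ p ∣ C suc k          ≡⟨ nCk+nC[k+1]≡[n+1]C[k+1] ∣ p ∣ k ⟩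
    suc ∣ p ∣ C suc k ∎

i-∷ : ∀ n k {m} (A : Family n (suc m)) →
      i[ n , k ] A ≡ ∣ headColumn A ∣ C k ℕ.+ i[ n , k ] (tailColumns A)
i-∷ n k A = begin
  i[ n , k ] A
    ≡⟨ cong sum (map-cong split (kSubsets n k)) ⟩
  sum (map (λ I → 𝟙 (does (I ⊆? headColumn A)) ℕ.+ ∣ interOver I (tailColumns A) ∣) (kSubsets n k))
    ≡⟨ sum-map-+ _ _ (kSubsets n k) ⟩
  kSubsetsWithin k (headColumn A) ℕ.+ i[ n , k ] (tailColumns A)
    ≡⟨ cong (ℕ._+ i[ n , k ] (tailColumns A)) (kSubsetsWithin≡C k (headColumn A)) ⟩
  ∣ headColumn A ∣ C k ℕ.+ i[ n , k ] (tailColumns A) ∎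
  where
  split : ∀ I → ∣ interOver I A ∣ ≡
                𝟙 (does (I ⊆? headColumn A)) ℕ.+ ∣ interOver I (tailColumns A) ∣
  split I = trans (cong ∣_∣ (interOver-∷ I A))
                  (∣b∷p∣≡𝟙b+∣p∣ (does (I ⊆? headColumn A)) (interOver I (tailColumns A)))

i-empty : ∀ n k (A : Family n 0) → i[ n , k ] A ≡ 0
i-empty n k A = sum-map-zero (λ I → ∣p∣≡0 (interOver I A)) (kSubsets n k)

formula-from-points : ∀ {n} (E : Expr n) (c : ℕ → ℤ) →
  (∀ p → + 𝟙 (evalᵇ E p) ≡ Σℤ[1… n ] (λ k → c k * + (∣ p ∣ C k))) →
  ∀ m (A : Family n m) → + ∣ eval E A ∣ ≡ Σℤ[1… n ] (λ k → c k * + (i[ n , k ] A))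
formula-from-points {n} E c at-point zero A = begin
  + ∣ eval E A ∣
    ≡⟨ cong +_ (∣p∣≡0 (eval E A)) ⟩
  + 0
    ≡⟨ sym (Σℤ-truncate {n = n} _ z≤n (λ k _ → trans (cong (λ x → c k * + x) (i-empty n k A))
                                                     (*-zeroʳ (c k)))) ⟩
  Σℤ[1… n ] (λ k → c k * + (i[ n , k ] A)) ∎
formula-from-points {n} E c at-point (suc m) A = begin
  + ∣ eval E A ∣
    ≡⟨ cong +_ (trans (cong ∣_∣ (eval-∷ E A))
                      (∣b∷p∣≡𝟙b+∣p∣ (evalᵇ E (headColumn A)) (eval E (tailColumns A)))) ⟩
  + (𝟙 (evalᵇ E (headColumn A)) ℕ.+ ∣ eval E (tailColumns A) ∣)
    ≡⟨ pos-+ (𝟙 (evalᵇ E (headColumn A))) _ ⟩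
  + 𝟙 (evalᵇ E (headColumn A)) + + ∣ eval E (tailColumns A) ∣
    ≡⟨ cong₂ _+_ (at-point (headColumn A)) (formula-from-points E c at-point m (tailColumns A)) ⟩
  Σℤ[1… n ] (λ k → c k * + (∣ headColumn A ∣ C k)) +
  Σℤ[1… n ] (λ k → c k * + (i[ n , k ] (tailColumns A)))
    ≡⟨ sym (Σℤ-+ n _ _) ⟩
  Σℤ[1… n ] (λ k → c k * + (∣ headColumn A ∣ C k) + c k * + (i[ n , k ] (tailColumns A)))
    ≡⟨ Σℤ-cong n (λ k → sym (split (suc k))) ⟩
  Σℤ[1… n ] (λ k → c k * + (i[ n , k ] A)) ∎
  where
  split : ∀ k → c k * + (i[ n , k ] A) ≡
                c k * + (∣ headColumn A ∣ C k) + c k * + (i[ n , k ] (tailColumns A))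
  split k = trans (cong (λ x → c k * + x) (i-∷ n k A))
                  (trans (cong (c k *_) (pos-+ (∣ headColumn A ∣ C k) _)) (*-distribˡ-+ (c k) _ _))

-- Inclusion–exclusion-like expressions and characteristic sets

point : ∀ {n} → Subset n → Family n 1
point p i = lookup p i ∷ []

headColumn-point : ∀ {n} (p : Subset n) → headColumn (point p) ≡ p
headColumn-point p = tabulate∘lookup p

eval-point : ∀ {n} (E : Expr n) (p : Subset n) → eval E (point p) ≡ evalᵇ E p ∷ []
eval-point E p with eval E (tailColumns (point p)) | eval-∷ E (point p)
... | [] | eval-∷-point = trans eval-∷-point (cong (λ q → evalᵇ E q ∷ []) (headColumn-point p))

∣eval-point∣ : ∀ {n} (E : Expr n) (p : Subset n) → ∣ eval E (point p) ∣ ≡ 𝟙 (evalᵇ E p)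
∣eval-point∣ E p =
  trans (cong ∣_∣ (eval-point E p)) (trans (∣b∷p∣≡𝟙b+∣p∣ (evalᵇ E p) []) (ℕ.+-identityʳ _))

i-point : ∀ n k (p : Subset n) → i[ n , k ] (point p) ≡ ∣ p ∣ C k
i-point n k p = begin
  i[ n , k ] (point p)
    ≡⟨ i-∷ n k (point p) ⟩
  ∣ headColumn (point p) ∣ C k ℕ.+ i[ n , k ] (tailColumns (point p))
    ≡⟨ cong₂ ℕ._+_ (cong (λ q → ∣ q ∣ C k) (headColumn-point p)) (i-empty n k _) ⟩
  ∣ p ∣ C k ℕ.+ 0
    ≡⟨ ℕ.+-identityʳ _ ⟩
  ∣ p ∣ C k ∎

evalᵇ-cong : ∀ {n} {E F : Expr n} → E ≅ F → ∀ p → evalᵇ E p ≡ evalᵇ F p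
evalᵇ-cong {E = E} {F} E≅F p =
  cong head (trans (sym (eval-point E p)) (trans (E≅F 1 (point p)) (eval-point F p)))

ℕ→ℚ∘𝟙-injective : ∀ a b → ℕ→ℚ (𝟙 a) ≡ ℕ→ℚ (𝟙 b) → a ≡ b
ℕ→ℚ∘𝟙-injective false false _  = refl
ℕ→ℚ∘𝟙-injective true  true  _  = refl
ℕ→ℚ∘𝟙-injective false true  ()
ℕ→ℚ∘𝟙-injective true  false ()

evalᵇ-cardinal : ∀ {n} (E : Expr n) → IncExcLike E →
                 ∀ (p q : Subset n) → ∣ p ∣ ≡ ∣ q ∣ → evalᵇ E p ≡ evalᵇ E q
evalᵇ-cardinal {n} E (c , formula) p q ∣p∣≡∣q∣ =
  ℕ→ℚ∘𝟙-injective _ _ (trans (value p) (trans (cong Σ[c*C] ∣p∣≡∣q∣) (sym (value q))))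
  where
  Σ[c*C] : ℕ → ℚ
  Σ[c*C] t = Σℚ[1… n ] (λ k → c k ℚ.* ℕ→ℚ (t C k))
  value : ∀ p → ℕ→ℚ (𝟙 (evalᵇ E p)) ≡ Σ[c*C] ∣ p ∣
  value p = begin
    ℕ→ℚ (𝟙 (evalᵇ E p))
      ≡⟨ cong ℕ→ℚ (sym (∣eval-point∣ E p)) ⟩
    ℕ→ℚ ∣ eval E (point p) ∣
      ≡⟨ formula 1 (point p) ⟩
    Σℚ[1… n ] (λ k → c k ℚ.* ℕ→ℚ (i[ n , k ] (point p)))
      ≡⟨ Σℚ-cong n (λ k → cong (λ x → c k ℚ.* ℕ→ℚ x) (i-point n k p)) ⟩
    Σ[c*C] ∣ p ∣ ∎

literal : ∀ {n} → Subset n → Fin n → Expr n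
literal I i = if lookup I i then X i else X i ᶜ

-- G is built from a function local to Defs; unification recovers it as the first component.
G-literals : ∀ {n} (I : Subset n) → Σ[ lit ∈ (Fin n → Expr n) ] G I ≡ ⋂ₑ (map lit (allFin n))
G-literals I = _ , refl

G≡⋂literal : ∀ {n} (I : Subset n) → G I ≡ ⋂ₑ (map (literal I) (allFin n))
G≡⋂literal {n} I = trans (proj₂ (G-literals I)) (cong ⋂ₑ (map-cong local≗literal (allFin n)))
  where
  local≗literal : ∀ i → proj₁ (G-literals I) i ≡ literal I i
  local≗literal i with lookup I i
  ... | true  = refl
  ... | false = refl

T-⋂ₑ-intro : ∀ {n} {p : Subset n} es →
             T (nonempty p) → All (λ e → T (evalᵇ e p)) es → T (evalᵇ (⋂ₑ es) p)
T-⋂ₑ-intro []       ne []         = Equivalence.from T-∧ (ne , _)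
T-⋂ₑ-intro (e ∷ es) ne (te ∷ tes) = Equivalence.from T-∧ (te , T-⋂ₑ-intro es ne tes)

T-⋂ₑ-elim : ∀ {n} {p : Subset n} es → T (evalᵇ (⋂ₑ es) p) → All (λ e → T (evalᵇ e p)) es
T-⋂ₑ-elim []       _ = []
T-⋂ₑ-elim (e ∷ es) t = proj₁ (Equivalence.to T-∧ t) ∷ T-⋂ₑ-elim es (proj₂ (Equivalence.to T-∧ t))

literal-agrees : ∀ {n} (I p : Subset n) i → T (evalᵇ (literal I i) p) → lookup I i ≡ lookup p i
literal-agrees I p i t with lookup I i
... | true  = sym (Equivalence.to T-≡ t)
... | false = sym (Equivalence.to T-not-≡ (proj₂ (Equivalence.to T-∧ t)))

literal-holds : ∀ {n} (I : Subset n) → T (nonempty I) → ∀ i → T (evalᵇ (literal I i) I)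
literal-holds I ne i with lookup I i in eq
... | true  = Equivalence.from T-≡ eq
... | false = Equivalence.from T-∧ (ne , Equivalence.from T-not-≡ eq)

G-unique : ∀ {n} {I p : Subset n} → T (evalᵇ (G I) p) → I ≡ p
G-unique {n} {I} {p} t = trans (sym (tabulate∘lookup I)) (trans (tabulate-cong agree) (tabulate∘lookup p))
  where
  literals : All (λ e → T (evalᵇ e p)) (map (literal I) (allFin n))
  literals = T-⋂ₑ-elim _ (subst (λ e → T (evalᵇ e p)) (G≡⋂literal I) t)
  agree : ∀ i → lookup I i ≡ lookup p i
  agree i = literal-agrees I p i (tabulate⁻ (map⁻ literals) i)

G-self : ∀ {n} {I : Subset n} → Nonempty I → T (evalᵇ (G I) I)
G-self {n} {I} ne = subst (λ e → T (evalᵇ e I)) (sym (G≡⋂literal I))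
  (T-⋂ₑ-intro _ (Nonempty⇒T-nonempty ne) (map⁺ (tabulate⁺ (literal-holds I (Nonempty⇒T-nonempty ne)))))

evalᵇ-F : ∀ {n} (S : List (Subset n)) p → evalᵇ (F_ S) p ≡ any (λ I → evalᵇ (G I) p) S
evalᵇ-F []      p = refl
evalᵇ-F (I ∷ S) p = cong (evalᵇ (G I) p ∨_) (evalᵇ-F S p)

T-evalᵇ⇔ : ∀ {n} (E : Expr n) (S : List (Subset n)) → IncExcLike E → IsCharacteristicSet E S →
           ∀ p → T (evalᵇ E p) ⇔ Any (λ J → ∣ J ∣ ≡ ∣ p ∣) S
T-evalᵇ⇔ E S incExc (nonempties , E≅F) p = mk⇔ pattern-in-S size-in-S
  where
  evalᵇ-E : ∀ q → evalᵇ E q ≡ any (λ I → evalᵇ (G I) q) S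
  evalᵇ-E q = trans (evalᵇ-cong {E = E} {F_ S} E≅F q) (evalᵇ-F S q)
  pattern-in-S : T (evalᵇ E p) → Any (λ J → ∣ J ∣ ≡ ∣ p ∣) S
  pattern-in-S t = Any.map (λ {J} → cong ∣_∣ ∘ G-unique {I = J} {p}) (any⁻ _ S (subst T (evalᵇ-E p) t))
  size-in-S : Any (λ J → ∣ J ∣ ≡ ∣ p ∣) S → T (evalᵇ E p)
  size-in-S any-J with find any-J
  ... | J , J∈S , ∣J∣≡∣p∣ = subst T (evalᵇ-cardinal E incExc J p ∣J∣≡∣p∣)
    (subst T (sym (evalᵇ-E J)) (any⁺ _ (lose J∈S (G-self (All.lookup nonempties J∈S)))))

𝟙-as-if : ∀ b → + 𝟙 b ≡ (if b then + 1 else + 0)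
𝟙-as-if false = refl
𝟙-as-if true  = refl

evalᵇ≡χC : ∀ {n} (E : Expr n) (S : List (Subset n)) → IncExcLike E → IsCharacteristicSet E S →
           ∀ p → + 𝟙 (evalᵇ E p) ≡ χC S ∣ p ∣
evalᵇ≡χC E S incExc charSet p =
  trans (cong (+_ ∘ 𝟙) (det (fromEquivalence (Equivalence.to E⇔) (Equivalence.from E⇔)) (proof J?)))
        (𝟙-as-if (does J?))
  where
  E⇔ = T-evalᵇ⇔ E S incExc charSet p
  J? = any? (λ J → ∣ J ∣ ℕ.≟ ∣ p ∣) S

χC-zero : ∀ {n} {S : List (Subset n)} → All Nonempty S → χC S 0 ≡ + 0
χC-zero {S = S} nonempties = cong (if_then + 1 else + 0)
  (dec-false (any? (λ J → ∣ J ∣ ℕ.≟ 0) S) (All¬⇒¬Any (All.map Nonempty⇒∣p∣≢0 nonempties)))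

theorem3p11 : (n : ℕ) → 1 ≤ n → (E : Expr n) → IncExcLike E →
    (S : List (Subset n)) → IsCharacteristicSet E S →
    ∀ (m : ℕ) (A : Family n m) →
      + ∣ eval E A ∣ ≡ Σℤ[1… n ] (λ k → coeff S k * + (i[ n , k ] A))
theorem3p11 n _ E incExc S charSet = formula-from-points E (coeff S) at-point
  where
  -- coeff S is binomialInverse (χC S) by definition.
  at-point : ∀ p → + 𝟙 (evalᵇ E p) ≡ Σℤ[1… n ] (λ k → coeff S k * + (∣ p ∣ C k))
  at-point p = begin
    + 𝟙 (evalᵇ E p)
      ≡⟨ evalᵇ≡χC E S incExc charSet p ⟩
    χC S ∣ p ∣
      ≡⟨ sym (binomial-inversion (χC S) (χC-zero (proj₁ charSet)) (∣p∣≤n p)) ⟩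
    Σℤ[1… n ] (λ k → coeff S k * + (∣ p ∣ C k)) ∎
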